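{- Let $\mathbb N_\bot$ be the poset whose underlying set is $\mathbb N+\mathbf 1$, ordered by the flat order: $\mathsf{inr}(\star)$ is the least element, and any two distinct elements of the form $\mathsf{inl}(n)$ are incomparable. If $\mathbb N_\bot$ is $\mathcal U_0$-directed complete, then LPO holds, i.e. \[\prod_{\alpha:\mathbb N\to\mathbf 2}\Big(\prod_{n:\mathbb N}\alpha(n)=0\Big)+\Big(\sum_{k:\mathbb N}\alpha(k)=1\Big).\]
   Context: The ambient theory is intensional Martin-Löf type theory with function extensionality, propositional extensionality and propositional truncation $\|-\|$. It has universes $\mathcal U_0:\mathcal U_1$, and $\mathcal U_0$ contains $\mathbf 0,\mathbf 1,\mathbb N$. No propositional resizing is assumed. A proposition is a type with at most one element. A poset is a set $X$ together with a proposition-valued relation $\le$ that is reflexive, antisymmetric and transitive. A family $u:I\to X$ is directed if $\|I\|$ holds and, for all $i,j:I$, we have $\big\|\sum_{k:I}(u_i\le u_k)\times(u_j\le u_k)\big\|$. A poset is $\mathcal U_0$-directed complete if every directed family indexed by a type in $\mathcal U_0$ has a least upper bound. -}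

module Defs where

open import Level using (Level; _⊔_; suc; zero; Setω)
open import Data.Nat using (ℕ)
open import Data.Bool using (Bool; true; false)
open import Data.Unit using (⊤; tt)
open import Data.Empty using (⊥)
open import Data.Sum using (_⊎_; inj₁; inj₂)
open import Data.Product using (Σ; _×_; _,_)
open import Relation.Binary.PropositionalEquality using (_≡_)

is-prop : ∀ {ℓ} → Set ℓ → Set ℓ
is-prop A = (x y : A) → x ≡ y

-- Propositional truncation, part of the ambient theory.  Agda (without
-- cubical) has no HITs, so it is supplied as a structure with its
-- usual introduction/elimination rules (elimination into propositions
-- of any universe).
record PropTrunc : Setω where
  field
    ∥_∥ : ∀ {ℓ} → Set ℓ → Set ℓ
    ∣_∣ : ∀ {ℓ} {A : Set ℓ} → A → ∥ A ∥
    ∥∥-is-prop : ∀ {ℓ} {A : Set ℓ} → is-prop ∥ A ∥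
    ∥∥-rec : ∀ {ℓ ℓ'} {A : Set ℓ} {P : Set ℓ'} → is-prop P → (A → P) → ∥ A ∥ → P

module _ (pt : PropTrunc) where
  open PropTrunc pt

  is-directed : ∀ {a r i} {X : Set a} (_≤_ : X → X → Set r) {I : Set i}
              → (I → X) → Set (r ⊔ i)
  is-directed _≤_ {I} u =
    ∥ I ∥ × ((i j : I) → ∥ Σ I (λ k → (u i ≤ u k) × (u j ≤ u k)) ∥)

  is-U₀-directed-complete : ∀ {a r} {X : Set a} (_≤_ : X → X → Set r) → Set (suc zero ⊔ a ⊔ r)
  is-U₀-directed-complete {X = X} _≤_ =
    (I : Set) (u : I → X) → is-directed _≤_ u → Σ X (λ s → is-lub s u)
    where
      is-lub : ∀ {I : Set} → X → (I → X) → Set _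
      is-lub {I} s u = ((i : I) → u i ≤ s) × ((t : X) → ((i : I) → u i ≤ t) → s ≤ t)

-- 𝟐 = Bool, with 0 = false and 1 = true.
-- ℕ⊥ : underlying set ℕ + 𝟏 with the flat order.
ℕ⊥ : Set
ℕ⊥ = ℕ ⊎ ⊤

_⊑_ : ℕ⊥ → ℕ⊥ → Set
inj₂ _ ⊑ _      = ⊤
inj₁ n ⊑ inj₁ m = n ≡ m
inj₁ _ ⊑ inj₂ _ = ⊥

LPO : Set
LPO = (α : ℕ → Bool) → ((n : ℕ) → α n ≡ false) ⊎ Σ ℕ (λ k → α k ≡ true)

-- The family consisting of ⊥ together with the least k such that α k = 1
-- (if any) is directed, since there is at most one such k.  In the flat
-- order its supremum is ⊥ exactly when α is constantly 0, and is inj₁ k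
-- exactly when k is that least index; inspecting the supremum decides LPO.
module Submission where

open import Defs
open import Level using (_⊔_)
open import Data.Nat using (ℕ; _<_)
open import Data.Nat.Induction using (<-rec)
open import Data.Nat.Properties using (<-cmp)
open import Data.Bool using (Bool; true; false)
open import Data.Unit using (⊤; tt)
open import Data.Empty using (⊥; ⊥-elim)
open import Data.Sum using (_⊎_; inj₁; inj₂)
open import Data.Product using (Σ; _×_; _,_)
open import Relation.Binary using (Reflexive; tri<; tri≈; tri>)
open import Relation.Binary.PropositionalEquality using (_≡_; refl; sym; subst)

⊑-refl : Reflexive _⊑_
⊑-refl {inj₁ _} = refl
⊑-refl {inj₂ _} = tt

IsLub : ∀ {a r} {X : Set a} → (X → X → Set r) → {I : Set} → (I → X) → X → Set (a ⊔ r)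
IsLub {X = X} _≤_ {I} u s = ((i : I) → u i ≤ s) × ((t : X) → ((i : I) → u i ≤ t) → s ≤ t)

module _ (α : ℕ → Bool) where

  IsLeastTrue : ℕ → Set
  IsLeastTrue k = (α k ≡ true) × ((j : ℕ) → j < k → α j ≡ false)

  private
    true≢false : ∀ {b} → b ≡ true → b ≡ false → ⊥
    true≢false refl ()

  isLeastTrue-unique : ∀ {k l} → IsLeastTrue k → IsLeastTrue l → k ≡ l
  isLeastTrue-unique {k} {l} (αk , below-k) (αl , below-l) with <-cmp k l
  ... | tri< k<l _ _ = ⊥-elim (true≢false αk (below-l k k<l))
  ... | tri≈ _ k≡l _ = k≡l
  ... | tri> _ _ l<k = ⊥-elim (true≢false αl (below-k l l<k))

  LeastTrueIndex : Set
  LeastTrueIndex = ⊤ ⊎ Σ ℕ IsLeastTrue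

  leastTrue : LeastTrueIndex → ℕ⊥
  leastTrue (inj₁ _)       = inj₂ tt
  leastTrue (inj₂ (k , _)) = inj₁ k

  leastTrue-joins : (i j : LeastTrueIndex) →
                    Σ LeastTrueIndex (λ k → (leastTrue i ⊑ leastTrue k) × (leastTrue j ⊑ leastTrue k))
  leastTrue-joins i (inj₁ _)       = i , ⊑-refl , tt
  leastTrue-joins (inj₁ _) j       = j , tt , ⊑-refl
  leastTrue-joins (inj₂ (k , least-k)) (inj₂ (l , least-l)) =
    inj₂ (k , least-k) , refl , sym (isLeastTrue-unique least-k least-l)

  leastTrue-directed : (pt : PropTrunc) → is-directed pt _⊑_ leastTrue
  leastTrue-directed pt = ∣ inj₁ tt ∣ , λ i j → ∣ leastTrue-joins i j ∣
    where open PropTrunc pt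

  -- Strong induction: a first index with α n = true would put inj₁ n below ⊥.
  ⊥-bounds-leastTrue⇒all-false : ((i : LeastTrueIndex) → leastTrue i ⊑ inj₂ tt) → (n : ℕ) → α n ≡ false
  ⊥-bounds-leastTrue⇒all-false ⊥-bound = <-rec (λ n → α n ≡ false) step
    where
    step : ∀ n → (∀ {j} → j < n → α j ≡ false) → α n ≡ false
    step n below-n with α n in αn
    ... | false = refl
    ... | true  = ⊥-elim (⊥-bound (inj₂ (n , αn , λ j j<n → below-n j<n)))

  lub-leastTrue-defined⇒true : ∀ {n} → IsLub _⊑_ leastTrue (inj₁ n) → α n ≡ true
  lub-leastTrue-defined⇒true {n} (upper , least) with α n in αn
  ... | true  = refl
  ... | false = ⊥-elim (least (inj₂ tt) ⊥-bound)
    where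
    -- Any member inj₁ k equals the supremum inj₁ n, so α n = α k = true.
    ⊥-bound : (i : LeastTrueIndex) → leastTrue i ⊑ inj₂ tt
    ⊥-bound (inj₁ _) = tt
    ⊥-bound (inj₂ (k , least-k@(αk , _))) =
      true≢false αk (subst (λ m → α m ≡ false) (sym (upper (inj₂ (k , least-k)))) αn)

lemma3p1 : (pt : PropTrunc) → is-U₀-directed-complete pt _⊑_ → LPO
lemma3p1 pt complete α with complete (LeastTrueIndex α) (leastTrue α) (leastTrue-directed α pt)
... | inj₂ tt , upper , _ = inj₁ (⊥-bounds-leastTrue⇒all-false α upper)
... | inj₁ n  , isLub     = inj₂ (n , lub-leastTrue-defined⇒true α isLub)
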